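{- The dominance monotone sets of graphs of cardinality $1$ are exactly $\{K_1\}$, $\{2K_1\}$, and $\{K_2\}$.
   Context: All graphs are finite and simple, considered up to isomorphism; $K_n$ is the complete graph on $n$ vertices and $2K_1$ is the graph with two vertices and no edges. For lists $d=(d_1,\dots,d_n)$ and $e=(e_1,\dots,e_p)$ of positive integers in nonincreasing order, $d\succeq e$ if $\sum d_i=\sum e_i$ and $\sum_{i=1}^k e_i\le\sum_{i=1}^k d_i$ for $1\le k\le\min\{p,n\}$. A graph is $\mathcal{F}$-free if no induced subgraph is isomorphic to an element of $\mathcal{F}$; a degree sequence is forcibly $\mathcal{F}$-free if every realization (graph with that degree sequence) is $\mathcal{F}$-free. $\mathcal{F}$ is dominance monotone if whenever $d,e$ are degree sequences with positive terms, $d\succeq e$, and $e$ is forcibly $\mathcal{F}$-free, then $d$ is forcibly $\mathcal{F}$-free. -}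

module Defs where

open import Data.Nat using (ℕ; zero; suc; _+_; _≤_; _<_; _≥_; _⊔_; _⊓_)
open import Data.Bool using (Bool; true; false; if_then_else_)
open import Data.Fin using (Fin; zero; suc)
open import Data.List using (List; []; _∷_; map; take; length; allFin)
open import Data.Nat.ListAction using (sum)
open import Data.List.Relation.Unary.All using (All)
open import Data.List.Relation.Unary.Linked using (Linked)
open import Data.List.Relation.Binary.Permutation.Propositional using (_↭_)
open import Data.Product using (Σ; _×_; _,_; ∃)
open import Relation.Binary.PropositionalEquality using (_≡_)
open import Relation.Nullary using (¬_)
open import Function.Definitions using (Injective)

record Graph (n : ℕ) : Set where
  field
    adj    : Fin n → Fin n → Bool
    sym    : ∀ i j → adj i j ≡ adj j i
    irrefl : ∀ i → adj i i ≡ false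
open Graph public

record _≅_ {k m : ℕ} (G : Graph k) (H : Graph m) : Set where
  field
    to      : Fin k → Fin m
    from    : Fin m → Fin k
    from∘to : ∀ i → from (to i) ≡ i
    to∘from : ∀ j → to (from j) ≡ j
    pres    : ∀ i j → adj H (to i) (to j) ≡ adj G i j

K1 : Graph 1
K1 = record { adj = λ _ _ → false ; sym = λ _ _ → _≡_.refl ; irrefl = λ _ → _≡_.refl }

2K1 : Graph 2
2K1 = record { adj = λ _ _ → false ; sym = λ _ _ → _≡_.refl ; irrefl = λ _ → _≡_.refl }

private
  neq : Fin 2 → Fin 2 → Bool
  neq zero zero = false
  neq zero (suc zero) = true
  neq (suc zero) zero = true
  neq (suc zero) (suc zero) = false

  neq-sym : ∀ i j → neq i j ≡ neq j i
  neq-sym zero zero = _≡_.refl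
  neq-sym zero (suc zero) = _≡_.refl
  neq-sym (suc zero) zero = _≡_.refl
  neq-sym (suc zero) (suc zero) = _≡_.refl

  neq-irr : ∀ i → neq i i ≡ false
  neq-irr zero = _≡_.refl
  neq-irr (suc zero) = _≡_.refl

K2 : Graph 2
K2 = record { adj = neq ; sym = neq-sym ; irrefl = neq-irr }

InducedIn : {k n : ℕ} → Graph k → Graph n → Set
InducedIn {k} {n} H G =
  Σ (Fin k → Fin n) λ f → Injective _≡_ _≡_ f × (∀ i j → adj G (f i) (f j) ≡ adj H i j)

Free : {k n : ℕ} → Graph k → Graph n → Set
Free H G = ¬ InducedIn H G

degree : {n : ℕ} → Graph n → Fin n → ℕ
degree {n} G v = sum (map (λ u → if adj G v u then 1 else 0) (allFin n))

degrees : {n : ℕ} → Graph n → List ℕ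
degrees {n} G = map (degree G) (allFin n)

Realizes : {n : ℕ} → Graph n → List ℕ → Set
Realizes G d = degrees G ↭ d

NonIncreasing : List ℕ → Set
NonIncreasing = Linked _≥_

Positive : List ℕ → Set
Positive = All (λ x → 0 < x)

IsDegSeq : List ℕ → Set
IsDegSeq d = NonIncreasing d × ∃ λ n → Σ (Graph n) λ G → Realizes G d

_⪰_ : List ℕ → List ℕ → Set
d ⪰ e = (sum d ≡ sum e) ×
        (∀ k → 1 ≤ k → k ≤ length e ⊓ length d → sum (take k e) ≤ sum (take k d))

ForciblyFree : {k : ℕ} → Graph k → List ℕ → Set
ForciblyFree H d = ∀ n (G : Graph n) → Realizes G d → Free H G

DominanceMonotone : {k : ℕ} → Graph k → Set
DominanceMonotone H =
  ∀ d e → IsDegSeq d → IsDegSeq e → Positive d → Positive e →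
  d ⪰ e → ForciblyFree H e → ForciblyFree H d

-- A positive forcibly K₁- or K₂-free sequence is empty, since every nonempty graph without
-- isolated vertices contains K₁ and K₂; and a forcibly 2K₁-free sequence of length n is that of
-- K_n, with degree sum n(n-1), which no graph on at most n vertices with a non-edge attains.
-- Conversely, a graph H on at least three vertices has a vertex with two neighbours or with two
-- non-neighbours. In the first case the prism H □ K₂ contains H, and its degree sequence dominates
-- (1,…,1), whose realizations have maximum degree 1. In the second case the complement of a
-- padded prism of the complement of H contains H, and its degree sequence dominates
-- (N-2,…,N-2), whose realizations give every vertex a single non-neighbour.
module Submission where

open import Data.Bool using (Bool; true; false; if_then_else_; not; _∧_; _∨_)
open import Data.Bool.Properties using (∧-identityʳ; not-involutive; ¬-not) renaming (_≟_ to _≟ᵇ_)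
open import Data.Fin using (Fin; zero; suc; _↑ˡ_; _↑ʳ_; splitAt)
open import Data.Fin.Properties using (_≟_; splitAt-↑ˡ; splitAt-↑ʳ; ↑ˡ-injective)
open import Data.List using (List; []; _∷_; _++_; map; tabulate; allFin; length; replicate; take; drop)
open import Data.List.Properties
  using ( length-map; length-tabulate; length-replicate; length-take; length-drop; length-++
        ; take++drop≡id; take-all)
open import Data.List.Relation.Binary.Permutation.Propositional using (↭-sym; ↭-reflexive)
open import Data.List.Relation.Binary.Permutation.Propositional.Properties using (All-resp-↭; ↭-length)
open import Data.List.Relation.Unary.All as All using (All; []; _∷_)
import Data.List.Relation.Unary.All.Properties as All
open import Data.List.Relation.Unary.AllPairs using (AllPairs; []; _∷_)
open import Data.List.Relation.Unary.Linked using ([]; [-]; _∷_)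
open import Data.List.Relation.Unary.Linked.Properties using (Linked⇒AllPairs)
open import Data.List.Relation.Unary.Unique.Propositional using (Unique)
import Data.List.Relation.Unary.Unique.Propositional.Properties as Unique
import Data.List.Sort
open import Data.Nat using (ℕ; zero; suc; pred; _+_; _*_; _∸_; _⊓_; _≤_; _<_; _≥_; z≤n; s≤s; >-nonZero)
open import Data.Nat.ListAction using (sum)
open import Data.Nat.ListAction.Properties using (sum-++; sum-↭)
open import Data.Nat.Properties hiding (_≟_)
open import Algebra.Properties.CommutativeMonoid.Sum +-0-commutativeMonoid
  using (sum-cong-≗; ∑-distrib-+) renaming (sum to ∑)
open import Algebra.Properties.CommutativeSemigroup *-commutativeSemigroup using (x∙yz≈y∙xz)
open import Data.Product using (∃; _,_; _×_; proj₁; proj₂)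
open import Data.Sum using (_⊎_; inj₁; inj₂; [_,_]′)
open import Defs hiding (sym)
open import Function using (_∘_; id; const; case_of_)
open import Function.Bundles using (_⇔_; mk⇔)
open import Relation.Binary.Construct.Flip.EqAndOrd using (decTotalOrder)
open import Relation.Binary.PropositionalEquality
  using (_≡_; _≢_; refl; sym; trans; cong; cong₂; subst; module ≡-Reasoning)
open import Relation.Nullary using (¬_; does; yes; no; contradiction)
open import Relation.Nullary.Decidable using (dec-true; dec-false)

∑-const : ∀ n c → ∑ {n} (λ _ → c) ≡ n * c
∑-const zero    c = refl
∑-const (suc n) c = cong (c +_) (∑-const n c)

∑-mono-≤ : ∀ {n} {g h : Fin n → ℕ} → (∀ i → g i ≤ h i) → ∑ g ≤ ∑ h
∑-mono-≤ {zero}  g≤h = z≤n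
∑-mono-≤ {suc n} g≤h = +-mono-≤ (g≤h zero) (∑-mono-≤ (g≤h ∘ suc))

∑-< : ∀ {n c} {h : Fin n → ℕ} x → (∀ i → h i ≤ c) → h x < c → ∑ h < n * c
∑-< {suc n} {c} zero    h≤c hx<c =
  +-mono-<-≤ hx<c (≤-trans (∑-mono-≤ (h≤c ∘ suc)) (≤-reflexive (∑-const n c)))
∑-< {suc n}     (suc x) h≤c hx<c = +-mono-≤-< (h≤c zero) (∑-< x (h≤c ∘ suc) hx<c)

∑-splitAt : ∀ m {n} (h : Fin (m + n) → ℕ) → ∑ h ≡ ∑ (h ∘ (_↑ˡ n)) + ∑ (h ∘ (m ↑ʳ_))
∑-splitAt zero    h = refl
∑-splitAt (suc m) h = trans (cong (h zero +_) (∑-splitAt m (h ∘ suc))) (sym (+-assoc (h zero) _ _))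

∑-suc : ∀ {n} (h : Fin n → ℕ) → ∑ (suc ∘ h) ≡ n + ∑ h
∑-suc {n} h = trans (∑-distrib-+ (const 1) h) (cong (_+ ∑ h) (trans (∑-const n 1) (*-identityʳ n)))

∑-splitAt-⊎ : ∀ m {n} (h : Fin m ⊎ Fin n → ℕ) →
              ∑ (h ∘ splitAt m) ≡ ∑ (h ∘ inj₁) + ∑ (h ∘ inj₂)
∑-splitAt-⊎ m {n} h = trans (∑-splitAt m (h ∘ splitAt m))
  (cong₂ _+_ (sum-cong-≗ λ i → cong h (splitAt-↑ˡ m i n))
             (sum-cong-≗ λ i → cong h (splitAt-↑ʳ m n i)))

sum-map-tabulate : ∀ {A : Set} {n} (g : Fin n → A) (h : A → ℕ) →
                   sum (map h (tabulate g)) ≡ ∑ (h ∘ g)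
sum-map-tabulate {n = zero}  g h = refl
sum-map-tabulate {n = suc n} g h = cong (h (g zero) +_) (sum-map-tabulate (g ∘ suc) h)

indicator : Bool → ℕ
indicator b = if b then 1 else 0

count : ∀ {n} → (Fin n → Bool) → ℕ
count p = ∑ (indicator ∘ p)

count-cong : ∀ {n} {p q : Fin n → Bool} → (∀ i → p i ≡ q i) → count p ≡ count q
count-cong p≗q = sum-cong-≗ (cong indicator ∘ p≗q)

count-false : ∀ n → count {n} (λ _ → false) ≡ 0
count-false n = trans (∑-const n 0) (*-zeroʳ n)

count-singleton : ∀ {n} (x : Fin n) → count (λ u → does (u ≟ x)) ≡ 1
count-singleton {suc n} zero    = cong suc (count-false n)
count-singleton {suc n} (suc x) = count-singleton x

count-complement : ∀ {n} (p : Fin n → Bool) → count p + count (not ∘ p) ≡ n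
count-complement {n} p = begin
  count p + count (not ∘ p)                         ≡⟨ ∑-distrib-+ (indicator ∘ p) (indicator ∘ not ∘ p) ⟨
  ∑ (λ i → indicator (p i) + indicator (not (p i))) ≡⟨ sum-cong-≗ (indicator-not ∘ p) ⟩
  ∑ {n} (λ _ → 1)                                   ≡⟨ trans (∑-const n 1) (*-identityʳ n) ⟩
  n                                                 ∎
  where
  open ≡-Reasoning
  indicator-not : ∀ b → indicator b + indicator (not b) ≡ 1
  indicator-not true  = refl
  indicator-not false = refl

count-remove : ∀ {n} (p : Fin n → Bool) {x} → p x ≡ true →
               count p ≡ suc (count (λ u → p u ∧ not (does (u ≟ x))))
count-remove {n} p {x} px = begin
  count p                                               ≡⟨ sum-cong-≗ split ⟩
  ∑ (λ u → indicator (p′ u) + indicator (does (u ≟ x))) ≡⟨ ∑-distrib-+ (indicator ∘ p′) _ ⟩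
  count p′ + count (λ u → does (u ≟ x))                 ≡⟨ cong (count p′ +_) (count-singleton x) ⟩
  count p′ + 1                                          ≡⟨ +-comm (count p′) 1 ⟩
  suc (count p′)                                        ∎
  where
  open ≡-Reasoning
  p′ : Fin n → Bool
  p′ u = p u ∧ not (does (u ≟ x))
  split : ∀ u → indicator (p u) ≡ indicator (p′ u) + indicator (does (u ≟ x))
  split u with u ≟ x | p u in pu
  ... | yes refl | false = contradiction (trans (sym pu) px) λ ()
  ... | yes refl | true  = refl
  ... | no _     | false = refl
  ... | no _     | true  = refl

count-≥-length : ∀ {n} (p : Fin n → Bool) {xs} → Unique xs → All (λ x → p x ≡ true) xs →
                 length xs ≤ count p
count-≥-length p [] [] = z≤n
count-≥-length p {x ∷ xs} (x∉xs ∷ unique) (px ∷ pxs) = begin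
  suc (length xs)
    ≤⟨ s≤s (count-≥-length _ unique (All.zipWith stillTrue (pxs , x∉xs))) ⟩
  suc (count (λ u → p u ∧ not (does (u ≟ x))))
    ≡⟨ count-remove p px ⟨
  count p
    ∎
  where
  open ≤-Reasoning
  stillTrue : ∀ {y} → p y ≡ true × x ≢ y → p y ∧ not (does (y ≟ x)) ≡ true
  stillTrue {y} (py , x≢y) with y ≟ x
  ... | yes refl = contradiction refl x≢y
  ... | no _     = trans (∧-identityʳ (p y)) py

count>0⇒∃ : ∀ {n} (p : Fin n → Bool) → 0 < count p → ∃ λ x → p x ≡ true
count>0⇒∃ {suc n} p count>0 with p zero in p0
... | true  = zero , p0
... | false with count>0⇒∃ (p ∘ suc) count>0
...   | x , px = suc x , px

sum-replicate : ∀ N c → sum (replicate N c) ≡ N * c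
sum-replicate zero    c = refl
sum-replicate (suc N) c = cong (c +_) (sum-replicate N c)

sum-take-replicate : ∀ j N c → sum (take j (replicate N c)) ≤ j * c
sum-take-replicate zero    N       c = z≤n
sum-take-replicate (suc j) zero    c = z≤n
sum-take-replicate (suc j) (suc N) c = +-monoʳ-≤ c (sum-take-replicate j N c)

sum≤length* : ∀ {c} (xs : List ℕ) → All (_≤ c) xs → sum xs ≤ length xs * c
sum≤length* []       []           = z≤n
sum≤length* (x ∷ xs) (x≤c ∷ xs≤c) = +-mono-≤ x≤c (sum≤length* xs xs≤c)

≤-sum-take : ∀ {d} → Positive d → ∀ j → j ≤ length d → j ≤ sum (take j d)
≤-sum-take _            zero    _         = z≤n
≤-sum-take (x>0 ∷ d>0) (suc j) (s≤s j≤n) = +-mono-≤ x>0 (≤-sum-take d>0 j j≤n)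

sum≡0⇒[] : ∀ {d} → Positive d → sum d ≡ 0 → d ≡ []
sum≡0⇒[] []           _  = refl
sum≡0⇒[] (s≤s _ ∷ _) ()

AllPairs-++⁻ : ∀ {A : Set} {R : A → A → Set} xs {ys} →
               AllPairs R (xs ++ ys) → All (λ x → All (R x) ys) xs
AllPairs-++⁻ []       _                = []
AllPairs-++⁻ (x ∷ xs) (Rx[xs++ys] ∷ r) = All.++⁻ʳ xs Rx[xs++ys] ∷ AllPairs-++⁻ xs r

length*sum-≤ : ∀ xs {ys : List ℕ} → All (λ x → All (x ≥_) ys) xs →
               length xs * sum ys ≤ length ys * sum xs
length*sum-≤ []       []            = z≤n
length*sum-≤ (x ∷ xs) {ys} (ys≤x ∷ r) = begin
  sum ys + length xs * sum ys        ≤⟨ +-mono-≤ (sum≤length* ys ys≤x) (length*sum-≤ xs r) ⟩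
  length ys * x + length ys * sum xs ≡⟨ *-distribˡ-+ (length ys) x (sum xs) ⟨
  length ys * (x + sum xs)           ∎
  where open ≤-Reasoning

-- take j d dominates drop j d entrywise.
j*sum≤length*sum-take : ∀ {d} → NonIncreasing d → ∀ j → j ≤ length d →
                        j * sum d ≤ length d * sum (take j d)
j*sum≤length*sum-take {d} nonIncreasing j j≤n = begin
  j * sum d                             ≡⟨ cong (λ l → j * sum l) xs++ys≡d ⟨
  j * sum (xs ++ ys)                    ≡⟨ cong (j *_) (sum-++ xs ys) ⟩
  j * (sum xs + sum ys)                 ≡⟨ *-distribˡ-+ j (sum xs) (sum ys) ⟩
  j * sum xs + j * sum ys               ≤⟨ +-monoʳ-≤ (j * sum xs) cross ⟩
  j * sum xs + length ys * sum xs       ≡⟨ *-distribʳ-+ (sum xs) j (length ys) ⟨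
  (j + length ys) * sum xs              ≡⟨ cong (_* sum xs) length-d ⟩
  length d * sum xs                     ∎
  where
  open ≤-Reasoning
  xs = take j d
  ys = drop j d
  xs++ys≡d : xs ++ ys ≡ d
  xs++ys≡d = take++drop≡id j d
  length-xs : length xs ≡ j
  length-xs = trans (length-take j d) (m≤n⇒m⊓n≡m j≤n)
  length-d : j + length ys ≡ length d
  length-d = trans (cong (_+ length ys) (sym length-xs)) (trans (sym (length-++ xs)) (cong length xs++ys≡d))
  xs≥ys : All (λ x → All (x ≥_) ys) xs
  xs≥ys = AllPairs-++⁻ xs (subst (AllPairs _≥_) (sym xs++ys≡d)
                                 (Linked⇒AllPairs (λ p q → ≤-trans q p) nonIncreasing))
  cross : j * sum ys ≤ length ys * sum xs
  cross = subst (λ l → l * sum ys ≤ length ys * sum xs) length-xs (length*sum-≤ xs xs≥ys)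

⪰-replicate-1 : ∀ {d N} → Positive d → sum d ≡ N → d ⪰ replicate N 1
⪰-replicate-1 {d} {N} d>0 sum≡N =
  trans sum≡N (sym (trans (sum-replicate N 1) (*-identityʳ N))) ,
  λ j _ j≤ → begin
    sum (take j (replicate N 1)) ≤⟨ sum-take-replicate j N 1 ⟩
    j * 1                        ≡⟨ *-identityʳ j ⟩
    j                            ≤⟨ ≤-sum-take d>0 j (≤-trans j≤ (m⊓n≤n _ (length d))) ⟩
    sum (take j d)               ∎
  where open ≤-Reasoning

⪰-replicate : ∀ {d N c} → NonIncreasing d → length d ≡ N → sum d ≡ N * c → d ⪰ replicate N c
⪰-replicate {d} {N} {c} nonIncreasing length≡N sum≡N*c =
  trans sum≡N*c (sym (sum-replicate N c)) , prefix
  where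
  prefix : ∀ j → 1 ≤ j → j ≤ length (replicate N c) ⊓ length d →
           sum (take j (replicate N c)) ≤ sum (take j d)
  prefix j j≥1 j≤ = ≤-trans (sum-take-replicate j N c) (*-cancelˡ-≤ N {{>-nonZero (≤-trans j≥1 j≤N)}} (begin
    N * (j * c)               ≡⟨ x∙yz≈y∙xz N j c ⟩
    j * (N * c)               ≡⟨ cong (j *_) sum≡N*c ⟨
    j * sum d                 ≤⟨ j*sum≤length*sum-take nonIncreasing j (subst (j ≤_) (sym length≡N) j≤N) ⟩
    length d * sum (take j d) ≡⟨ cong (_* sum (take j d)) length≡N ⟩
    N * sum (take j d)        ∎))
    where
    open ≤-Reasoning
    j≤N : j ≤ N
    j≤N = ≤-trans j≤ (≤-trans (m⊓n≤m _ (length d)) (≤-reflexive (length-replicate N)))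

⪰-length : ∀ {d e} → Positive d → d ⪰ e → length d ≤ length e
⪰-length {d} {[]}    d>0 (sum≡ , _) = ≤-reflexive (cong length (sum≡0⇒[] d>0 sum≡))
⪰-length {d} {e@(_ ∷ _)} d>0 (sum≡ , prefix) with ≤-total (length d) (length e)
... | inj₁ d≤e = d≤e
... | inj₂ e≤d =
  m∸n≡0⇒m≤n (trans (sym (length-drop N d)) (cong length (sum≡0⇒[] (All.drop⁺ N d>0) sum-drop≡0)))
  where
  N = length e
  sum-drop≡0 : sum (drop N d) ≡ 0
  sum-drop≡0 = n≤0⇒n≡0 (+-cancelˡ-≤ (sum (take N d)) _ 0 (begin
    sum (take N d) + sum (drop N d) ≡⟨ sum-++ (take N d) (drop N d) ⟨
    sum (take N d ++ drop N d)      ≡⟨ cong sum (take++drop≡id N d) ⟩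
    sum d                           ≡⟨ sum≡ ⟩
    sum e                           ≡⟨ cong sum (take-all N e ≤-refl) ⟨
    sum (take N e)                  ≤⟨ prefix N (s≤s z≤n) (⊓-glb ≤-refl e≤d) ⟩
    sum (take N d)                  ≡⟨ +-identityʳ _ ⟨
    sum (take N d) + 0              ∎))
    where open ≤-Reasoning

replicate-nonIncreasing : ∀ N c → NonIncreasing (replicate N c)
replicate-nonIncreasing zero          c = []
replicate-nonIncreasing (suc zero)    c = [-]
replicate-nonIncreasing (suc (suc N)) c = ≤-refl ∷ replicate-nonIncreasing (suc N) c

replicate-positive : ∀ N {c} → 0 < c → Positive (replicate N c)
replicate-positive N = All.replicate⁺ N

All-≡⇒replicate : ∀ {c} (xs : List ℕ) → All (_≡ c) xs → xs ≡ replicate (length xs) c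
All-≡⇒replicate []       []           = refl
All-≡⇒replicate (x ∷ xs) (refl ∷ xs≡c) = cong (x ∷_) (All-≡⇒replicate xs xs≡c)

degree≡count : ∀ {n} (G : Graph n) v → degree G v ≡ count (adj G v)
degree≡count G v = sum-map-tabulate id (indicator ∘ adj G v)

sum-degrees : ∀ {n} (G : Graph n) → sum (degrees G) ≡ ∑ (degree G)
sum-degrees G = sum-map-tabulate id (degree G)

length-degrees : ∀ {n} (G : Graph n) → length (degrees G) ≡ n
length-degrees {n} G = trans (length-map (degree G) (allFin n)) (length-tabulate id)

degrees⁺ : ∀ {n} {P : ℕ → Set} (G : Graph n) → (∀ v → P (degree G v)) → All P (degrees G)
degrees⁺ G = All.map⁺ ∘ All.tabulate⁺

degrees⁻ : ∀ {n} {P : ℕ → Set} (G : Graph n) → All P (degrees G) → ∀ v → P (degree G v)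
degrees⁻ G = All.tabulate⁻ ∘ All.map⁻

degree+nonDegree : ∀ {n} (G : Graph n) v → degree G v + count (not ∘ adj G v) ≡ n
degree+nonDegree G v =
  trans (cong (_+ count (not ∘ adj G v)) (degree≡count G v)) (count-complement (adj G v))

degree<n : ∀ {n} (G : Graph n) v → degree G v < n
degree<n {n} G v = begin
  suc (degree G v)                     ≡⟨ +-comm 1 (degree G v) ⟩
  degree G v + 1                       ≤⟨ +-monoʳ-≤ (degree G v) notAdjacentToItself ⟩
  degree G v + count (not ∘ adj G v)   ≡⟨ degree+nonDegree G v ⟩
  n                                    ∎
  where
  open ≤-Reasoning
  notAdjacentToItself : 1 ≤ count (not ∘ adj G v)
  notAdjacentToItself = count-≥-length (not ∘ adj G v) ([] ∷ []) (cong not (irrefl G v) ∷ [])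

sum-realizes : ∀ {n d} {G : Graph n} → Realizes G d → sum d ≡ ∑ (degree G)
sum-realizes {G = G} G⊨d = trans (sym (sum-↭ G⊨d)) (sum-degrees G)

length-realizes : ∀ {n d} {G : Graph n} → Realizes G d → length d ≡ n
length-realizes {G = G} G⊨d = trans (sym (↭-length G⊨d)) (length-degrees G)

realizes-replicate : ∀ {n c} (G : Graph n) → (∀ v → degree G v ≡ c) → Realizes G (replicate n c)
realizes-replicate {c = c} G regular = ↭-reflexive (trans
  (All-≡⇒replicate (degrees G) (degrees⁺ G regular)) (cong (λ l → replicate l c) (length-degrees G)))

realizes-replicate⁻ : ∀ {n N c} (G : Graph n) → Realizes G (replicate N c) →
                      n ≡ N × (∀ v → degree G v ≡ c)
realizes-replicate⁻ {N = N} {c} G realizes =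
  trans (sym (length-degrees G)) (trans (↭-length realizes) (length-replicate N)) ,
  degrees⁻ {P = _≡ c} G (All-resp-↭ (↭-sym realizes) (All.replicate⁺ N refl))

module ≥-Sort = Data.List.Sort (decTotalOrder ≤-decTotalOrder)

degreeSequence : ∀ {n} → Graph n → List ℕ
degreeSequence G = ≥-Sort.sort (degrees G)

degreeSequence-realizes : ∀ {n} (G : Graph n) → Realizes G (degreeSequence G)
degreeSequence-realizes G = ↭-sym (≥-Sort.sort-↭ (degrees G))

degreeSequence-nonIncreasing : ∀ {n} (G : Graph n) → NonIncreasing (degreeSequence G)
degreeSequence-nonIncreasing G = ≥-Sort.sort-↗ (degrees G)

degreeSequence-isDegSeq : ∀ {n} (G : Graph n) → IsDegSeq (degreeSequence G)
degreeSequence-isDegSeq G = degreeSequence-nonIncreasing G , _ , G , degreeSequence-realizes G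

degreeSequence-positive : ∀ {n} (G : Graph n) → (∀ v → 0 < degree G v) → Positive (degreeSequence G)
degreeSequence-positive G G>0 = All-resp-↭ (degreeSequence-realizes G) (degrees⁺ G G>0)

sum-degreeSequence : ∀ {n} (G : Graph n) → sum (degreeSequence G) ≡ ∑ (degree G)
sum-degreeSequence G = sum-realizes {G = G} (degreeSequence-realizes G)

length-degreeSequence : ∀ {n} (G : Graph n) → length (degreeSequence G) ≡ n
length-degreeSequence G = length-realizes {G = G} (degreeSequence-realizes G)

does-≟-sym : ∀ {n} (i j : Fin n) → does (i ≟ j) ≡ does (j ≟ i)
does-≟-sym i j with i ≟ j
... | yes i≡j = sym (dec-true (j ≟ i) (sym i≡j))
... | no  i≢j = sym (dec-false (j ≟ i) (i≢j ∘ sym))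

emptyGraph : ∀ n → Graph n
emptyGraph n = record { adj = λ _ _ → false ; sym = λ _ _ → refl ; irrefl = λ _ → refl }

degree-emptyGraph : ∀ {n} (v : Fin n) → degree (emptyGraph n) v ≡ 0
degree-emptyGraph {n} v = trans (degree≡count (emptyGraph n) v) (count-false n)

complement : ∀ {n} → Graph n → Graph n
complement G = record
  { adj    = λ i j → not (does (j ≟ i) ∨ adj G i j)
  ; sym    = λ i j → cong₂ (λ e a → not (e ∨ a)) (does-≟-sym j i) (Graph.sym G i j)
  ; irrefl = λ i → cong (λ e → not (e ∨ adj G i i)) (dec-true (i ≟ i) refl)
  }

adj-complement : ∀ {n} (G : Graph n) {i j} → i ≢ j → adj (complement G) i j ≡ not (adj G i j)
adj-complement G {i} {j} i≢j = cong (λ e → not (e ∨ adj G i j)) (dec-false (j ≟ i) (i≢j ∘ sym))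

degree-complement : ∀ {n} (G : Graph n) v → degree (complement G) v + suc (degree G v) ≡ n
degree-complement {n} G v = begin
  degree Gᶜ v + suc (degree G v)
    ≡⟨ cong₂ (λ a b → a + suc b) (degree≡count Gᶜ v) (degree≡count G v) ⟩
  count (adj Gᶜ v) + suc (count (adj G v))
    ≡⟨ cong (λ k → count (adj Gᶜ v) + (k + count (adj G v))) (count-singleton v) ⟨
  count (adj Gᶜ v) + (count isV + count (adj G v))
    ≡⟨ cong (count (adj Gᶜ v) +_) (∑-distrib-+ (indicator ∘ isV) (indicator ∘ adj G v)) ⟨
  count (adj Gᶜ v) + ∑ (λ u → indicator (isV u) + indicator (adj G v u))
    ≡⟨ ∑-distrib-+ (indicator ∘ adj Gᶜ v) _ ⟨
  ∑ (λ u → indicator (adj Gᶜ v u) + (indicator (isV u) + indicator (adj G v u)))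
    ≡⟨ sum-cong-≗ partition ⟩
  ∑ {n} (λ _ → 1)
    ≡⟨ trans (∑-const n 1) (*-identityʳ n) ⟩
  n ∎
  where
  open ≡-Reasoning
  Gᶜ : Graph n
  Gᶜ = complement G
  isV : Fin n → Bool
  isV u = does (u ≟ v)
  partition : ∀ u → indicator (adj Gᶜ v u) + (indicator (isV u) + indicator (adj G v u)) ≡ 1
  partition u with u ≟ v | adj G v u in vu
  ... | yes refl | true  = contradiction (trans (sym vu) (irrefl G v)) λ ()
  ... | yes refl | false = refl
  ... | no _     | true  = refl
  ... | no _     | false = refl

∑-degree-complement : ∀ {n} (G : Graph n) → ∑ (degree (complement G)) + (n + ∑ (degree G)) ≡ n * n
∑-degree-complement {n} G = begin
  ∑ (degree Gᶜ) + (n + ∑ (degree G))         ≡⟨ cong (∑ (degree Gᶜ) +_) (∑-suc (degree G)) ⟨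
  ∑ (degree Gᶜ) + ∑ (suc ∘ degree G)         ≡⟨ ∑-distrib-+ (degree Gᶜ) (suc ∘ degree G) ⟨
  ∑ (λ v → degree Gᶜ v + suc (degree G v))   ≡⟨ sum-cong-≗ (degree-complement G) ⟩
  ∑ {n} (λ _ → n)                            ≡⟨ ∑-const n n ⟩
  n * n                                      ∎
  where
  open ≡-Reasoning
  Gᶜ : Graph n
  Gᶜ = complement G

module SplitGraph {m n : ℕ} (E : Fin m ⊎ Fin n → Fin m ⊎ Fin n → Bool)
                  (E-sym : ∀ x y → E x y ≡ E y x) (E-irrefl : ∀ x → E x x ≡ false) where

  graph : Graph (m + n)
  graph = record
    { adj    = λ i j → E (splitAt m i) (splitAt m j)
    ; sym    = λ i j → E-sym (splitAt m i) (splitAt m j)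
    ; irrefl = E-irrefl ∘ splitAt m
    }

  degree-graph : ∀ x → degree graph x ≡
                       count (E (splitAt m x) ∘ inj₁) + count (E (splitAt m x) ∘ inj₂)
  degree-graph x = trans (degree≡count graph x) (∑-splitAt-⊎ m (indicator ∘ E (splitAt m x)))

  graph-induced : (A : Graph m) → (∀ i j → E (inj₁ i) (inj₁ j) ≡ adj A i j) → InducedIn A graph
  graph-induced A E≡A =
    (_↑ˡ n) , (λ {i} {j} → ↑ˡ-injective n i j) ,
    λ i j → trans (cong₂ E (splitAt-↑ˡ m i n) (splitAt-↑ˡ m j n)) (E≡A i j)

⊕-adj : ∀ {m n} → Graph m → Graph n → Fin m ⊎ Fin n → Fin m ⊎ Fin n → Bool
⊕-adj A B (inj₁ i) (inj₁ j) = adj A i j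
⊕-adj A B (inj₁ i) (inj₂ j) = false
⊕-adj A B (inj₂ i) (inj₁ j) = false
⊕-adj A B (inj₂ i) (inj₂ j) = adj B i j

⊕-adj-sym : ∀ {m n} (A : Graph m) (B : Graph n) x y → ⊕-adj A B x y ≡ ⊕-adj A B y x
⊕-adj-sym A B (inj₁ i) (inj₁ j) = Graph.sym A i j
⊕-adj-sym A B (inj₁ i) (inj₂ j) = refl
⊕-adj-sym A B (inj₂ i) (inj₁ j) = refl
⊕-adj-sym A B (inj₂ i) (inj₂ j) = Graph.sym B i j

⊕-adj-irrefl : ∀ {m n} (A : Graph m) (B : Graph n) x → ⊕-adj A B x x ≡ false
⊕-adj-irrefl A B (inj₁ i) = irrefl A i
⊕-adj-irrefl A B (inj₂ i) = irrefl B i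

_⊕_ : ∀ {m n} → Graph m → Graph n → Graph (m + n)
A ⊕ B = SplitGraph.graph (⊕-adj A B) (⊕-adj-sym A B) (⊕-adj-irrefl A B)

module _ {m n} (A : Graph m) (B : Graph n) where

  open SplitGraph (⊕-adj A B) (⊕-adj-sym A B) (⊕-adj-irrefl A B)

  degree-⊕ : ∀ x → degree (A ⊕ B) x ≡ [ degree A , degree B ]′ (splitAt m x)
  degree-⊕ x = trans (degree-graph x) (split (splitAt m x))
    where
    split : ∀ s → count (⊕-adj A B s ∘ inj₁) + count (⊕-adj A B s ∘ inj₂) ≡
                  [ degree A , degree B ]′ s
    split (inj₁ i) =
      trans (cong₂ _+_ (sym (degree≡count A i)) (count-false n)) (+-identityʳ (degree A i))
    split (inj₂ j) = cong₂ _+_ (count-false m) (sym (degree≡count B j))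

  ∑-degree-⊕ : ∑ (degree (A ⊕ B)) ≡ ∑ (degree A) + ∑ (degree B)
  ∑-degree-⊕ = trans (sum-cong-≗ degree-⊕) (∑-splitAt-⊎ m [ degree A , degree B ]′)

  degree-⊕-≤ : ∀ {c} → (∀ i → degree A i ≤ c) → (∀ j → degree B j ≤ c) →
               ∀ x → degree (A ⊕ B) x ≤ c
  degree-⊕-≤ {c} A≤c B≤c x = subst (_≤ c) (sym (degree-⊕ x)) (bounded (splitAt m x))
    where
    bounded : ∀ s → [ degree A , degree B ]′ s ≤ c
    bounded (inj₁ i) = A≤c i
    bounded (inj₂ j) = B≤c j

  ⊕-induced : InducedIn A (A ⊕ B)
  ⊕-induced = graph-induced A λ _ _ → refl

prism-adj : ∀ {m} → Graph m → Fin m ⊎ Fin m → Fin m ⊎ Fin m → Bool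
prism-adj A (inj₁ i) (inj₁ j) = adj A i j
prism-adj A (inj₁ i) (inj₂ j) = does (j ≟ i)
prism-adj A (inj₂ i) (inj₁ j) = does (j ≟ i)
prism-adj A (inj₂ i) (inj₂ j) = adj A i j

prism-adj-sym : ∀ {m} (A : Graph m) x y → prism-adj A x y ≡ prism-adj A y x
prism-adj-sym A (inj₁ i) (inj₁ j) = Graph.sym A i j
prism-adj-sym A (inj₁ i) (inj₂ j) = does-≟-sym j i
prism-adj-sym A (inj₂ i) (inj₁ j) = does-≟-sym j i
prism-adj-sym A (inj₂ i) (inj₂ j) = Graph.sym A i j

prism-adj-irrefl : ∀ {m} (A : Graph m) x → prism-adj A x x ≡ false
prism-adj-irrefl A (inj₁ i) = irrefl A i
prism-adj-irrefl A (inj₂ i) = irrefl A i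

prism : ∀ {m} → Graph m → Graph (m + m)
prism A = SplitGraph.graph (prism-adj A) (prism-adj-sym A) (prism-adj-irrefl A)

module _ {m} (A : Graph m) where

  open SplitGraph (prism-adj A) (prism-adj-sym A) (prism-adj-irrefl A)

  degree-prism : ∀ x → degree (prism A) x ≡ suc (degree A ([ id , id ]′ (splitAt m x)))
  degree-prism x = trans (degree-graph x) (split (splitAt m x))
    where
    split : ∀ s → count (prism-adj A s ∘ inj₁) + count (prism-adj A s ∘ inj₂) ≡
                  suc (degree A ([ id , id ]′ s))
    split (inj₁ i) =
      trans (cong₂ _+_ (sym (degree≡count A i)) (count-singleton i)) (+-comm (degree A i) 1)
    split (inj₂ i) = cong₂ _+_ (count-singleton i) (sym (degree≡count A i))

  ∑-degree-prism : ∑ (degree (prism A)) ≡ ∑ (suc ∘ degree A) + ∑ (suc ∘ degree A)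
  ∑-degree-prism = trans (sum-cong-≗ degree-prism) (∑-splitAt-⊎ m (suc ∘ degree A ∘ [ id , id ]′))

  prism-induced : InducedIn A (prism A)
  prism-induced = graph-induced A λ _ _ → refl

matching : ∀ T → Graph (T + T)
matching T = prism (emptyGraph T)

degree-matching : ∀ T x → degree (matching T) x ≡ 1
degree-matching T x =
  trans (degree-prism (emptyGraph T) x) (cong suc (degree-emptyGraph ([ id , id ]′ (splitAt T x))))

cocktailParty : ∀ T → Graph (T + T)
cocktailParty T = complement (matching T)

degree-cocktailParty : ∀ T x → degree (cocktailParty T) x + 2 ≡ T + T
degree-cocktailParty T x = trans (cong (λ d → degree (cocktailParty T) x + suc d) (sym (degree-matching T x)))
                                 (degree-complement (matching T) x)

≅-sym : ∀ {k m} {H : Graph k} {H′ : Graph m} → H ≅ H′ → H′ ≅ H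
≅-sym {H = H} {H′} iso = record
  { to = from ; from = to ; from∘to = to∘from ; to∘from = from∘to
  ; pres = λ i j → trans (sym (pres (from i) (from j))) (cong₂ (adj H′) (to∘from i) (to∘from j))
  }
  where open _≅_ iso

InducedIn-resp-≅ : ∀ {k m n} {H : Graph k} {H′ : Graph m} {G : Graph n} →
                   H ≅ H′ → InducedIn H G → InducedIn H′ G
InducedIn-resp-≅ {H = H} {H′} {G} iso (f , f-inj , f-pres) =
  f ∘ from ,
  (λ {i} {j} eq → trans (sym (to∘from i)) (trans (cong to (f-inj eq)) (to∘from j))) ,
  λ i j → trans (f-pres (from i) (from j)) (_≅_.pres (≅-sym iso) i j)
  where open _≅_ iso

ForciblyFree-resp-≅ : ∀ {k m} {H : Graph k} {H′ : Graph m} {e} →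
                      H ≅ H′ → ForciblyFree H′ e → ForciblyFree H e
ForciblyFree-resp-≅ iso H′-free n G G⊨e = H′-free n G G⊨e ∘ InducedIn-resp-≅ {G = G} iso

DominanceMonotone-resp-≅ : ∀ {k m} {H : Graph k} {H′ : Graph m} →
                           H ≅ H′ → DominanceMonotone H′ → DominanceMonotone H
DominanceMonotone-resp-≅ iso monotone d e d-seq e-seq d>0 e>0 d⪰e e-free =
  ForciblyFree-resp-≅ iso
    (monotone d e d-seq e-seq d>0 e>0 d⪰e (ForciblyFree-resp-≅ (≅-sym iso) e-free))

InducedIn-trans : ∀ {k m n} {F : Graph k} {G : Graph m} {H : Graph n} →
                  InducedIn F G → InducedIn G H → InducedIn F H
InducedIn-trans (f , f-inj , f-pres) (g , g-inj , g-pres) =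
  g ∘ f , f-inj ∘ g-inj , λ i j → trans (g-pres (f i) (f j)) (f-pres i j)

complement-induced : ∀ {k n} {H : Graph k} {G : Graph n} →
                     InducedIn (complement H) G → InducedIn H (complement G)
complement-induced {H = H} {G} (f , f-inj , f-pres) = f , f-inj , pres
  where
  pres : ∀ i j → adj (complement G) (f i) (f j) ≡ adj H i j
  pres i j with i ≟ j
  ... | yes refl = trans (irrefl (complement G) (f i)) (sym (irrefl H i))
  ... | no  i≢j  = begin
    adj (complement G) (f i) (f j) ≡⟨ adj-complement G (i≢j ∘ f-inj) ⟩
    not (adj G (f i) (f j))        ≡⟨ cong not (f-pres i j) ⟩
    not (adj (complement H) i j)   ≡⟨ cong not (adj-complement H i≢j) ⟩
    not (not (adj H i j))          ≡⟨ not-involutive (adj H i j) ⟩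
    adj H i j                      ∎
    where open ≡-Reasoning

Graph₁-≅ : (H H′ : Graph 1) → H ≅ H′
Graph₁-≅ H H′ = record
  { to = id ; from = id ; from∘to = λ _ → refl ; to∘from = λ _ → refl
  ; pres = λ { zero zero → trans (irrefl H′ zero) (sym (irrefl H zero)) }
  }

Graph₂-≅ : (H H′ : Graph 2) → adj H zero (suc zero) ≡ adj H′ zero (suc zero) → H ≅ H′
Graph₂-≅ H H′ same = record
  { to = id ; from = id ; from∘to = λ _ → refl ; to∘from = λ _ → refl ; pres = pres }
  where
  pres : ∀ i j → adj H′ i j ≡ adj H i j
  pres zero       zero       = trans (irrefl H′ zero) (sym (irrefl H zero))
  pres zero       (suc zero) = sym same
  pres (suc zero) zero       = trans (Graph.sym H′ _ _) (trans (sym same) (Graph.sym H _ _))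
  pres (suc zero) (suc zero) = trans (irrefl H′ (suc zero)) (sym (irrefl H (suc zero)))

vertex-induced : ∀ {n} (H : Graph 1) (G : Graph n) (v : Fin n) → InducedIn H G
vertex-induced H G v =
  (λ _ → v) , (λ { {zero} {zero} _ → refl }) , λ { zero zero → trans (irrefl G v) (sym (irrefl H zero)) }

pair-induced : ∀ {n} (H : Graph 2) (G : Graph n) {x y} →
               x ≢ y → adj G x y ≡ adj H zero (suc zero) → InducedIn H G
pair-induced H G {x} {y} x≢y xy = f , f-inj , f-pres
  where
  f : Fin 2 → Fin _
  f zero       = x
  f (suc zero) = y
  f-inj : ∀ {i j} → f i ≡ f j → i ≡ j
  f-inj {zero}     {zero}     _  = refl
  f-inj {zero}     {suc zero} eq = contradiction eq x≢y
  f-inj {suc zero} {zero}     eq = contradiction (sym eq) x≢y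
  f-inj {suc zero} {suc zero} _  = refl
  f-pres : ∀ i j → adj G (f i) (f j) ≡ adj H i j
  f-pres zero       zero       = trans (irrefl G x) (sym (irrefl H zero))
  f-pres zero       (suc zero) = xy
  f-pres (suc zero) zero       = trans (Graph.sym G y x) (trans xy (Graph.sym H _ _))
  f-pres (suc zero) (suc zero) = trans (irrefl G y) (sym (irrefl H (suc zero)))

-- The only positive forcibly H-free sequence is then [], which dominates only itself.
freeOnlyIfEmpty⇒dominanceMonotone : ∀ {k} (H : Graph (suc k)) →
  (∀ {n} (G : Graph n) → (∀ v → 0 < degree G v) → Free H G → n ≡ 0) → DominanceMonotone H
freeOnlyIfEmpty⇒dominanceMonotone H freeOnlyIfEmpty
  d e _ (_ , n , E , E⊨e) d>0 e>0 (sum≡ , _) e-free m G G⊨d (f , _)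
  with freeOnlyIfEmpty E (degrees⁻ E (All-resp-↭ (↭-sym E⊨e) e>0)) (e-free n E E⊨e)
... | refl with sum≡0⇒[] d>0 (trans sum≡ (sum-realizes {G = E} E⊨e))
...   | refl with length-realizes {G = G} G⊨d
...     | refl with f zero
...       | ()

dominanceMonotone-K1 : DominanceMonotone K1
dominanceMonotone-K1 = freeOnlyIfEmpty⇒dominanceMonotone K1 freeOnlyIfEmpty
  where
  freeOnlyIfEmpty : ∀ {n} (G : Graph n) → (∀ v → 0 < degree G v) → Free K1 G → n ≡ 0
  freeOnlyIfEmpty {zero}  G _ _    = refl
  freeOnlyIfEmpty {suc n} G _ free = contradiction (vertex-induced K1 G zero) free

dominanceMonotone-K2 : DominanceMonotone K2
dominanceMonotone-K2 = freeOnlyIfEmpty⇒dominanceMonotone K2 freeOnlyIfEmpty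
  where
  freeOnlyIfEmpty : ∀ {n} (G : Graph n) → (∀ v → 0 < degree G v) → Free K2 G → n ≡ 0
  freeOnlyIfEmpty {zero}  G _   _    = refl
  freeOnlyIfEmpty {suc n} G G>0 free
    with count>0⇒∃ (adj G zero) (subst (0 <_) (degree≡count G zero) (G>0 zero))
  ... | u , 0~u = contradiction (pair-induced K2 G 0≢u 0~u) free
    where
    0≢u : zero ≢ u
    0≢u refl = contradiction (trans (sym 0~u) (irrefl G zero)) λ ()

∑-degree-complete : ∀ {n} (G : Graph n) → (∀ x y → x ≢ y → adj G x y ≡ true) →
                    ∑ (degree G) ≡ n * pred n
∑-degree-complete {n} G complete = trans (sum-cong-≗ degree≡pred) (∑-const n (pred n))
  where
  onlySelf : ∀ v u → not (adj G v u) ≡ does (u ≟ v)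
  onlySelf v u with u ≟ v
  ... | yes refl = cong not (irrefl G v)
  ... | no  u≢v  = cong not (complete v u (u≢v ∘ sym))
  degree≡pred : ∀ v → degree G v ≡ pred n
  degree≡pred v = cong pred (begin
    suc (degree G v)                   ≡⟨ +-comm 1 (degree G v) ⟩
    degree G v + 1
      ≡⟨ cong (degree G v +_) (trans (count-cong (onlySelf v)) (count-singleton v)) ⟨
    degree G v + count (not ∘ adj G v) ≡⟨ degree+nonDegree G v ⟩
    n                                  ∎)
    where open ≡-Reasoning

∑-degree<-nonComplete : ∀ {n} (G : Graph n) {x y} → x ≢ y → adj G x y ≡ false →
                        ∑ (degree G) < n * pred n
∑-degree<-nonComplete {n} G {x} {y} x≢y xy =
  ∑-< x (λ v → <⇒≤pred (degree<n G v)) (<⇒≤pred x-misses-two)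
  where
  open ≤-Reasoning
  x-misses-two : suc (degree G x) < n
  x-misses-two = begin
    suc (suc (degree G x))             ≡⟨ +-comm 2 (degree G x) ⟩
    degree G x + 2                     ≤⟨ +-monoʳ-≤ (degree G x) (count-≥-length (not ∘ adj G x)
                                            ((x≢y ∷ []) ∷ [] ∷ []) (cong not (irrefl G x) ∷ cong not xy ∷ [])) ⟩
    degree G x + count (not ∘ adj G x) ≡⟨ degree+nonDegree G x ⟩
    n                                  ∎

-- By dominance the realization G of d has at most as many vertices as the complete graph
-- realizing e, yet it misses an edge and has the same degree sum.
dominanceMonotone-2K1 : DominanceMonotone 2K1
dominanceMonotone-2K1 d e _ (_ , n , E , E⊨e) d>0 _ d⪰e e-free p G G⊨d (f , f-inj , f-pres) =
  <-irrefl refl (begin-strict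
    sum d        ≡⟨ sum-realizes {G = G} G⊨d ⟩
    ∑ (degree G) <⟨ ∑-degree<-nonComplete G (λ eq → case f-inj eq of λ ()) (f-pres zero (suc zero)) ⟩
    p * pred p   ≤⟨ *-mono-≤ p≤n (pred-mono-≤ p≤n) ⟩
    n * pred n   ≡⟨ ∑-degree-complete E complete ⟨
    ∑ (degree E) ≡⟨ sum-realizes {G = E} E⊨e ⟨
    sum e        ≡⟨ proj₁ d⪰e ⟨
    sum d        ∎)
  where
  open ≤-Reasoning
  complete : ∀ x y → x ≢ y → adj E x y ≡ true
  complete x y x≢y with adj E x y in xy
  ... | true  = refl
  ... | false = contradiction (pair-induced 2K1 E x≢y xy) (e-free n E E⊨e)
  p≤n : p ≤ n
  p≤n = begin
    p        ≡⟨ length-realizes {G = G} G⊨d ⟨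
    length d ≤⟨ ⪰-length d>0 d⪰e ⟩
    length e ≡⟨ length-realizes {G = E} E⊨e ⟩
    n        ∎

counterexample⇒¬dominanceMonotone : ∀ {k n} {H : Graph k} (G : Graph n) {e} →
  InducedIn H G → (∀ v → 0 < degree G v) → IsDegSeq e → Positive e →
  degreeSequence G ⪰ e → ForciblyFree H e → ¬ DominanceMonotone H
counterexample⇒¬dominanceMonotone G H⊆G G>0 e-seq e>0 d⪰e e-free monotone =
  monotone _ _ (degreeSequence-isDegSeq G) e-seq (degreeSequence-positive G G>0) e>0 d⪰e e-free
    _ G (degreeSequence-realizes G) H⊆G

-- For b = true the three vertices induce a P₃ or K₃ through centre; for b = false they do so
-- in the complement.
record Cherry {k} (H : Graph k) (b : Bool) : Set where
  field
    centre leaf₁ leaf₂ : Fin k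
    distinct : Unique (centre ∷ leaf₁ ∷ leaf₂ ∷ [])
    adj₁ : adj H centre leaf₁ ≡ b
    adj₂ : adj H centre leaf₂ ≡ b

private
  v₀ v₁ v₂ : ∀ {k} → Fin (3 + k)
  v₀ = zero
  v₁ = suc zero
  v₂ = suc (suc zero)

-- Two of the three pairs among v₀, v₁, v₂ agree in adjacency, and any two pairs share a vertex.
cherry : ∀ {k} (H : Graph (3 + k)) → ∃ (Cherry H)
cherry H with adj H v₀ v₁ ≟ᵇ adj H v₀ v₂ | adj H v₀ v₁ ≟ᵇ adj H v₁ v₂
... | yes 01≡02 | _         = _ , record
  { centre = v₀ ; leaf₁ = v₁ ; leaf₂ = v₂ ; adj₁ = refl ; adj₂ = sym 01≡02
  ; distinct = ((λ ()) ∷ (λ ()) ∷ []) ∷ ((λ ()) ∷ []) ∷ [] ∷ []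
  }
... | no  _     | yes 01≡12 = _ , record
  { centre = v₁ ; leaf₁ = v₀ ; leaf₂ = v₂ ; adj₁ = refl ; adj₂ = sym (trans (Graph.sym H v₁ v₀) 01≡12)
  ; distinct = ((λ ()) ∷ (λ ()) ∷ []) ∷ ((λ ()) ∷ []) ∷ [] ∷ []
  }
... | no  01≢02 | no  01≢12 = _ , record
  { centre = v₂ ; leaf₁ = v₀ ; leaf₂ = v₁ ; adj₁ = refl
  ; adj₂ = trans (Graph.sym H v₂ v₁)
                 (trans (¬-not (01≢12 ∘ sym)) (sym (trans (Graph.sym H v₂ v₀) (¬-not (01≢02 ∘ sym)))))
  ; distinct = ((λ ()) ∷ (λ ()) ∷ []) ∷ ((λ ()) ∷ []) ∷ [] ∷ []
  }

cherry-neighbours : ∀ {k n} {H : Graph k} {G : Graph n} → InducedIn H G → Cherry H true →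
                    ∃ λ v → 2 ≤ degree G v
cherry-neighbours {G = G} (f , f-inj , f-pres) c = f centre , subst (2 ≤_) (sym (degree≡count G (f centre)))
  (count-≥-length (adj G (f centre)) (Unique.map⁺ f-inj leaves-distinct)
    (trans (f-pres centre leaf₁) adj₁ ∷ trans (f-pres centre leaf₂) adj₂ ∷ []))
  where
  open Cherry c
  leaves-distinct : Unique (leaf₁ ∷ leaf₂ ∷ [])
  leaves-distinct with _ ∷ distinct′ ← distinct = distinct′

cherry-nonNeighbours : ∀ {k n} {H : Graph k} {G : Graph n} → InducedIn H G → Cherry H false →
  ∃ λ v → 3 ≤ count (not ∘ adj G v)
cherry-nonNeighbours {G = G} (f , f-inj , f-pres) c = f centre ,
  count-≥-length (not ∘ adj G (f centre)) (Unique.map⁺ f-inj distinct)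
    (cong not (irrefl G (f centre)) ∷ cong not (trans (f-pres centre leaf₁) adj₁) ∷
     cong not (trans (f-pres centre leaf₂) adj₂) ∷ [])
  where open Cherry c

cherry⇒replicate-1-forciblyFree : ∀ {k} {H : Graph k} → Cherry H true →
                                  ∀ N → ForciblyFree H (replicate N 1)
cherry⇒replicate-1-forciblyFree c N n G G⊨e H⊆G with cherry-neighbours {G = G} H⊆G c
... | v , 2≤deg = <-irrefl refl (subst (2 ≤_) (proj₂ (realizes-replicate⁻ G G⊨e) v) 2≤deg)

cherry⇒replicate-forciblyFree : ∀ {k} {H : Graph k} → Cherry H false → ∀ {N c} → c + 2 ≡ N →
  ForciblyFree H (replicate N c)
cherry⇒replicate-forciblyFree c {N} {c′} c′+2≡N n G G⊨e H⊆G
  with cherry-nonNeighbours {G = G} H⊆G c | realizes-replicate⁻ G G⊨e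
... | v , 3≤count | n≡N , regular = <-irrefl refl (+-cancelˡ-≤ c′ 3 2 (begin
  c′ + 3                             ≤⟨ +-monoʳ-≤ c′ 3≤count ⟩
  c′ + count (not ∘ adj G v)         ≡⟨ cong (_+ count (not ∘ adj G v)) (regular v) ⟨
  degree G v + count (not ∘ adj G v) ≡⟨ degree+nonDegree G v ⟩
  n                                  ≡⟨ trans n≡N (sym c′+2≡N) ⟩
  c′ + 2                             ∎))
  where open ≤-Reasoning

cherry⇒¬dominanceMonotone : ∀ {k} {H : Graph k} → Cherry H true → ¬ DominanceMonotone H
cherry⇒¬dominanceMonotone {H = H} c =
  counterexample⇒¬dominanceMonotone {H = H} (prism H) (prism-induced H) prism>0
    e-isDegSeq (replicate-positive (T + T) (s≤s z≤n))
    (⪰-replicate-1 (degreeSequence-positive (prism H) prism>0)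
                   (trans (sum-degreeSequence (prism H)) (∑-degree-prism H)))
    (cherry⇒replicate-1-forciblyFree c (T + T))
  where
  T : ℕ
  T = ∑ (suc ∘ degree H)
  prism>0 : ∀ v → 0 < degree (prism H) v
  prism>0 v = subst (0 <_) (sym (degree-prism H v)) (s≤s z≤n)
  e-isDegSeq : IsDegSeq (replicate (T + T) 1)
  e-isDegSeq = replicate-nonIncreasing (T + T) 1 , _ , matching T ,
               realizes-replicate (matching T) (degree-matching T)

-- Padding the prism of the complement of H with isolated vertices until the vertex count N
-- equals its degree sum, and complementing again, gives a graph containing H whose degree sum
-- is that of the complement of a perfect matching on N vertices.
module PaddedComplement {k} (H : Graph (2 + k)) where

  K T N padding : ℕ
  K = 2 + k
  T = ∑ λ v → suc (degree (complement H) v)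
  N = T + T
  padding = N ∸ (K + K)

  private
    C : Graph K
    C = complement H
    R : Graph (K + K + padding)
    R = prism C ⊕ emptyGraph padding

  graph : Graph (K + K + padding)
  graph = complement R

  K+K≤N : K + K ≤ N
  K+K≤N = +-mono-≤ K≤T K≤T
    where
    K≤T : K ≤ T
    K≤T = subst (_≤ T) (trans (∑-const K 1) (*-identityʳ K))
                (∑-mono-≤ {h = λ v → suc (degree C v)} λ _ → s≤s z≤n)

  vertices≡N : K + K + padding ≡ N
  vertices≡N = m+[n∸m]≡n K+K≤N

  graph-induced : InducedIn H graph
  graph-induced = complement-induced {H = H} {G = R}
    (InducedIn-trans {F = C} {prism C} {R} (prism-induced C) (⊕-induced (prism C) (emptyGraph padding)))

  private
    degree-R≤K : ∀ x → degree R x ≤ K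
    degree-R≤K = degree-⊕-≤ (prism C) (emptyGraph padding)
                   prism≤K (λ j → subst (_≤ K) (sym (degree-emptyGraph j)) z≤n)
      where
      prism≤K : ∀ x → degree (prism C) x ≤ K
      prism≤K x = subst (_≤ K) (sym (degree-prism C x)) (degree<n C ([ id , id ]′ (splitAt K x)))

    ∑-degree-R : ∑ (degree R) ≡ N
    ∑-degree-R = begin
      ∑ (degree R)
        ≡⟨ ∑-degree-⊕ (prism C) (emptyGraph padding) ⟩
      ∑ (degree (prism C)) + ∑ (degree (emptyGraph padding))
        ≡⟨ cong₂ _+_ (∑-degree-prism C) (sum-cong-≗ (degree-emptyGraph {padding})) ⟩
      N + ∑ {padding} (const 0)
        ≡⟨ cong (N +_) (trans (∑-const padding 0) (*-zeroʳ padding)) ⟩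
      N + 0
        ≡⟨ +-identityʳ N ⟩
      N ∎
      where open ≡-Reasoning

  graph-positive : ∀ x → 0 < degree graph x
  graph-positive x = +-cancelʳ-≤ (suc (degree R x)) 1 (degree graph x) (begin
    2 + degree R x                    ≤⟨ +-mono-≤ (s≤s (s≤s z≤n)) (degree-R≤K x) ⟩
    K + K                             ≤⟨ m≤m+n (K + K) padding ⟩
    K + K + padding                   ≡⟨ degree-complement R x ⟨
    degree graph x + suc (degree R x) ∎)
    where open ≤-Reasoning

  ∑-degree-graph : ∑ (degree graph) + (N + N) ≡ N * N
  ∑-degree-graph = begin
    ∑ (degree graph) + (N + N)
      ≡⟨ cong₂ (λ m r → ∑ (degree graph) + (m + r)) vertices≡N ∑-degree-R ⟨
    ∑ (degree graph) + (K + K + padding + ∑ (degree R))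
      ≡⟨ ∑-degree-complement R ⟩
    (K + K + padding) * (K + K + padding)
      ≡⟨ cong₂ _*_ vertices≡N vertices≡N ⟩
    N * N ∎
    where open ≡-Reasoning

coCherry⇒¬dominanceMonotone : ∀ {k} {H : Graph (2 + k)} → Cherry H false → ¬ DominanceMonotone H
coCherry⇒¬dominanceMonotone {k} {H} ch =
  counterexample⇒¬dominanceMonotone {H = H} graph graph-induced graph-positive
    e-isDegSeq (replicate-positive N c>0)
    (⪰-replicate (degreeSequence-nonIncreasing graph) (trans (length-degreeSequence graph) vertices≡N)
                 (trans (sum-degreeSequence graph) ∑-degree≡N*c))
    (cherry⇒replicate-forciblyFree ch c+2≡N)
  where
  open PaddedComplement H
  open ≡-Reasoning
  c : ℕ
  c = N ∸ 2
  4≤N : 4 ≤ N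
  4≤N = ≤-trans (+-mono-≤ (s≤s (s≤s (z≤n {k}))) (s≤s (s≤s z≤n))) K+K≤N
  c+2≡N : c + 2 ≡ N
  c+2≡N = m∸n+n≡m (≤-trans (s≤s (s≤s z≤n)) 4≤N)
  c>0 : 0 < c
  c>0 = +-cancelʳ-≤ 2 1 c (≤-trans (≤-trans (s≤s (s≤s (s≤s z≤n))) 4≤N) (≤-reflexive (sym c+2≡N)))
  ∑-degree≡N*c : ∑ (degree graph) ≡ N * c
  ∑-degree≡N*c = +-cancelʳ-≡ (N + N) _ _ (begin
    ∑ (degree graph) + (N + N) ≡⟨ ∑-degree-graph ⟩
    N * N                      ≡⟨ cong (N *_) c+2≡N ⟨
    N * (c + 2)                ≡⟨ *-distribˡ-+ N c 2 ⟩
    N * c + N * 2              ≡⟨ cong (N * c +_) (trans (*-comm N 2) (cong (N +_) (+-identityʳ N))) ⟩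
    N * c + (N + N)            ∎)
  e-isDegSeq : IsDegSeq (replicate N c)
  e-isDegSeq = replicate-nonIncreasing N c , N , cocktailParty T ,
    realizes-replicate (cocktailParty T) λ x →
      +-cancelʳ-≡ 2 _ _ (trans (degree-cocktailParty T x) (sym c+2≡N))

¬dominanceMonotone : ∀ {k} (H : Graph (3 + k)) → ¬ DominanceMonotone H
¬dominanceMonotone H with cherry H
... | true  , ch = cherry⇒¬dominanceMonotone ch
... | false , ch = coCherry⇒¬dominanceMonotone ch

theorem3p5 : ∀ {k : ℕ} (H : Graph k) → 1 ≤ k →
    (DominanceMonotone H ⇔ (H ≅ K1 ⊎ H ≅ 2K1 ⊎ H ≅ K2))
theorem3p5 H k≥1 = mk⇔ (classify H k≥1) dominanceMonotone
  where
  classify : ∀ {k} (H : Graph k) → 1 ≤ k → DominanceMonotone H → H ≅ K1 ⊎ H ≅ 2K1 ⊎ H ≅ K2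
  classify {1} H _ _ = inj₁ (Graph₁-≅ H K1)
  classify {2} H _ _ with adj H zero (suc zero) in h01
  ... | false = inj₂ (inj₁ (Graph₂-≅ H 2K1 h01))
  ... | true  = inj₂ (inj₂ (Graph₂-≅ H K2 h01))
  classify {suc (suc (suc k))} H _ monotone = contradiction monotone (¬dominanceMonotone H)
  dominanceMonotone : H ≅ K1 ⊎ H ≅ 2K1 ⊎ H ≅ K2 → DominanceMonotone H
  dominanceMonotone (inj₁ H≅K1)        = DominanceMonotone-resp-≅ H≅K1 dominanceMonotone-K1
  dominanceMonotone (inj₂ (inj₁ H≅2K1)) = DominanceMonotone-resp-≅ H≅2K1 dominanceMonotone-2K1
  dominanceMonotone (inj₂ (inj₂ H≅K2)) = DominanceMonotone-resp-≅ H≅K2 dominanceMonotone-K2
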